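{- Let $m\ge 3$ and $n\ge 1$ be integers. Up to switching isomorphism, the number of distinct signatures on the Book graph $B(m,n)$ is $n+1$.
   Context: For integers $m\ge 3$, $n\ge 1$, the Book graph $B(m,n)$ is the simple graph with vertex set $\{u,v\}\cup\{u_j^l : 1\le l\le n,\ 1\le j\le m-2\}$ consisting of the $n$ cycles $C_m^l = u\,u_1^l\,u_2^l\cdots u_{m-2}^l\,v\,u$ ($l=1,\dots,n$), which pairwise share exactly the edge $uv$. A signature on a graph $G$ is a subset $\Sigma\subseteq E(G)$ (the set of negative edges; all other edges are positive). Switching (resigning) at a vertex $x$ changes the sign of every edge incident to $x$; two signatures are switching equivalent if one is obtained from the other by a sequence of switchings. Two signatures $\Sigma_1,\Sigma_2$ on $G$ are switching isomorphic if there is a signature $\Sigma_2'$ switching equivalent to $\Sigma_2$ and a graph automorphism $f$ of $G$ such that $xy\in\Sigma_1$ if and only if $f(x)f(y)\in\Sigma_2'$. -}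

module Defs where

open import Data.Nat using (ℕ; zero; suc; _∸_; _≡ᵇ_)
open import Data.Fin using (Fin; toℕ)
open import Data.Bool using (Bool; true; false; _∧_; _∨_; _xor_)
open import Data.Product using (Σ; ∃; _×_)
open import Relation.Binary.PropositionalEquality using (_≡_)
open import Relation.Binary.Construct.Closure.ReflexiveTransitive using (Star)

-- Vertices of the Book graph B(m,n):
--   u, v, and  w l j  standing for  u_{j+1}^{l+1}
--   (l : Fin n  ~  1 ≤ l ≤ n,   j : Fin (m ∸ 2)  ~  1 ≤ j ≤ m-2).
data Vtx (m n : ℕ) : Set where
  vu : Vtx m n
  vv : Vtx m n
  w  : Fin n → Fin (m ∸ 2) → Vtx m n

eqV : ∀ {m n} → Vtx m n → Vtx m n → Bool
eqV vu vu = true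
eqV vv vv = true
eqV (w l j) (w l' j') = (toℕ l ≡ᵇ toℕ l') ∧ (toℕ j ≡ᵇ toℕ j')
eqV _ _ = false

-- Adjacency of the Book graph B(m,n) (the union of the cycles
-- u u_1^l ... u_{m-2}^l v u, all sharing the edge uv).
adj : ∀ {m n} → Vtx m n → Vtx m n → Bool
adj vu vu = false
adj vv vv = false
adj vu vv = true
adj vv vu = true
adj vu (w l j) = toℕ j ≡ᵇ 0
adj (w l j) vu = toℕ j ≡ᵇ 0
adj {m} vv (w l j) = suc (toℕ j) ≡ᵇ (m ∸ 2)
adj {m} (w l j) vv = suc (toℕ j) ≡ᵇ (m ∸ 2)
adj (w l j) (w l' j') =
  (toℕ l ≡ᵇ toℕ l') ∧ ((suc (toℕ j) ≡ᵇ toℕ j') ∨ (suc (toℕ j') ≡ᵇ toℕ j))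

-- A (candidate) signature is given by its indicator on ordered vertex pairs:
-- σ x y ≡ true  means the edge xy is negative.
SigFun : ℕ → ℕ → Set
SigFun m n = Vtx m n → Vtx m n → Bool

IsSignature : ∀ {m n} → SigFun m n → Set
IsSignature σ =
  (∀ x y → σ x y ≡ σ y x) × (∀ x y → σ x y ≡ true → adj x y ≡ true)

switchAt : ∀ {m n} → Vtx m n → SigFun m n → SigFun m n
switchAt x σ a b = σ a b xor (adj a b ∧ (eqV a x ∨ eqV b x))

OneSwitch : ∀ {m n} → SigFun m n → SigFun m n → Set
OneSwitch {m} {n} σ τ = Σ (Vtx m n) λ x → ∀ a b → τ a b ≡ switchAt x σ a b

SwitchEquiv : ∀ {m n} → SigFun m n → SigFun m n → Set
SwitchEquiv = Star OneSwitch

IsAutomorphism : ∀ {m n} → (Vtx m n → Vtx m n) → Set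
IsAutomorphism {m} {n} f =
  (Σ (Vtx m n → Vtx m n) λ g → (∀ x → f (g x) ≡ x) × (∀ x → g (f x) ≡ x))
  × (∀ x y → adj (f x) (f y) ≡ adj x y)

SwitchIso : ∀ {m n} → SigFun m n → SigFun m n → Set
SwitchIso {m} {n} σ₁ σ₂ =
  Σ (SigFun m n) λ σ₂' → SwitchEquiv σ₂ σ₂' ×
    (Σ (Vtx m n → Vtx m n) λ f → IsAutomorphism f ×
       (∀ x y → σ₁ x y ≡ σ₂' (f x) (f y)))

-- "Up to switching isomorphism there are exactly k signatures on B(m,n)":
-- there are k signatures, pairwise not switching isomorphic, such that every
-- signature is switching isomorphic to one of them.
NumClasses : ℕ → ℕ → ℕ → Set
NumClasses m n k =
  Σ (Fin k → SigFun m n) λ rep →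
    (∀ i → IsSignature (rep i)) ×
    (∀ i j → SwitchIso (rep i) (rep j) → i ≡ j) ×
    (∀ σ → IsSignature σ → ∃ λ i → SwitchIso σ (rep i))

module Submission where

open import Defs
open import Data.Nat using (ℕ; zero; suc; _∸_; _≤_; _<_; z≤n; s≤s; _≡ᵇ_; _<ᵇ_)
open import Data.Nat.Properties using (≡ᵇ⇒≡; ≡⇒≡ᵇ; <ᵇ⇒<; <⇒<ᵇ; ≤-refl; ≤-trans; ≤-antisym; n≤1+n; m≤n⇒m≤1+n; suc-injective; <⇒≢)
open import Data.Fin using (Fin; zero; suc; toℕ; fromℕ; fromℕ<; inject≤; punchIn)
open import Data.Fin.Properties using (toℕ-injective; toℕ<n; toℕ-fromℕ; toℕ-fromℕ<; toℕ-inject≤; inject≤-injective; injective⇒≤; toℕ≤pred[n])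
open import Data.Fin.Permutation as Perm using (Permutation′; _⟨$⟩ʳ_; _⟨$⟩ˡ_; inverseˡ; inverseʳ; lift₀; insert; insert-punchIn)
open import Data.Bool using (Bool; true; false; _∧_; _∨_; _xor_; if_then_else_)
open import Data.Bool.Properties using (xor-assoc; xor-comm; xor-same; xor-identityʳ; not-involutive; ∧-distribˡ-xor; ∧-zeroʳ; ∧-identityʳ; ∧-assoc; ∨-comm; ∨-zeroʳ; T-≡; xor-∧-commutativeRing)
open import Data.Empty using (⊥; ⊥-elim)
open import Data.Unit using (⊤; tt)
open import Data.Sum using (_⊎_; inj₁; inj₂)
open import Data.Product using (Σ; ∃; _×_; _,_; proj₁; proj₂)
open import Data.List using (List; []; _∷_; _++_; map)
open import Data.List.Properties using (map-++)
open import Data.List.Relation.Unary.All as All using (All; []; _∷_)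
open import Data.List.Relation.Unary.All.Properties using (map⁺)
open import Function.Bundles using (Equivalence)
open import Relation.Nullary using (¬_)
open import Relation.Binary.PropositionalEquality using (_≡_; _≢_; refl; sym; trans; cong; cong₂; subst; module ≡-Reasoning)
open import Relation.Binary.Construct.Closure.ReflexiveTransitive using (ε; _◅_; _◅◅_)
open import Algebra.Bundles using (CommutativeRing; CommutativeMonoid)
open CommutativeRing xor-∧-commutativeRing using (+-commutativeMonoid; semiring)
open import Algebra.Properties.CommutativeSemigroup (CommutativeMonoid.commutativeSemigroup +-commutativeMonoid) using (interchange)
open import Algebra.Properties.Semiring.Sum semiring using (sum-syntax; *-distribˡ-sum; sum-cong-≗; sum-replicate-zero)
open ≡-Reasoning

-- Switching by a potential p (at every vertex where p is true) is a switching
-- equivalence, and the sign parity of a closed walk is a switching invariant.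
-- Switching by the parity of the path from u in the spanning tree  uv ∪ (pages
-- without their top edge)  makes all tree edges positive, so every signature is a
-- switching of a canonical one whose negative edges are top edges u_{m-2}ˡ v; the
-- set S of these pages is read off from the parities of the page cycles.  Relabelling
-- pages sorts S, so the representatives  rep i = "pages l < i negative"  cover.
-- Distinctness: switching isomorphisms transport closed-walk parities.  The
-- all-positive rep 0 is isomorphic only to itself (settling n = 1); for n ≥ 2 the
-- vertices u, v are the only ones of degree ≥ 3, so an automorphism permutes the
-- pages and page cycles, and counting negative pages gives i = j.

xor-cancelˡ : ∀ x y → x xor (x xor y) ≡ y
xor-cancelˡ false y = refl
xor-cancelˡ true  y = not-involutive y

xor-cancelʳ : ∀ x y → (x xor y) xor y ≡ x
xor-cancelʳ x y = trans (xor-assoc x y y) (trans (cong (x xor_) (xor-same y)) (xor-identityʳ x))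

xor-telescope : ∀ x y z → (x xor y) xor (y xor z) ≡ x xor z
xor-telescope x y z = trans (xor-assoc x y (y xor z)) (cong (x xor_) (xor-cancelˡ y z))

∨-as-xor : ∀ x y → (x ≡ true → y ≡ true → ⊥) → x ∨ y ≡ x xor y
∨-as-xor true  true  both = ⊥-elim (both refl refl)
∨-as-xor true  false _    = refl
∨-as-xor false y     _    = refl

true≢false : true ≢ false
true≢false ()

-- Case split on a Boolean without abstracting it in the goal.
true-or-false : ∀ x → x ≡ true ⊎ x ≡ false
true-or-false true  = inj₁ refl
true-or-false false = inj₂ refl

∧-true : ∀ {x y} → x ∧ y ≡ true → x ≡ true × y ≡ true
∧-true {true} e = refl , e

∨-true : ∀ {x y} → x ∨ y ≡ true → x ≡ true ⊎ y ≡ true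
∨-true {true}  _ = inj₁ refl
∨-true {false} e = inj₂ e

bool-ext : ∀ {x y} → (x ≡ true → y ≡ true) → (y ≡ true → x ≡ true) → x ≡ y
bool-ext {true}          x⇒y _   = sym (x⇒y refl)
bool-ext {false} {true}  _   y⇒x = y⇒x refl
bool-ext {false} {false} _   _   = refl

≡ᵇ-true⇒≡ : ∀ a b → (a ≡ᵇ b) ≡ true → a ≡ b
≡ᵇ-true⇒≡ a b e = ≡ᵇ⇒≡ a b (Equivalence.from T-≡ e)

≡⇒≡ᵇ-true : ∀ {a b} → a ≡ b → (a ≡ᵇ b) ≡ true
≡⇒≡ᵇ-true {a} {b} e = Equivalence.to T-≡ (≡⇒≡ᵇ a b e)

≡ᵇ-refl : ∀ a → (a ≡ᵇ a) ≡ true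
≡ᵇ-refl a = ≡⇒≡ᵇ-true {a} refl

≡ᵇ-sym : ∀ a b → (a ≡ᵇ b) ≡ (b ≡ᵇ a)
≡ᵇ-sym a b = bool-ext (λ e → ≡⇒≡ᵇ-true (sym (≡ᵇ-true⇒≡ a b e)))
                     (λ e → ≡⇒≡ᵇ-true (sym (≡ᵇ-true⇒≡ b a e)))

suc-≡ᵇ-self : ∀ t → (suc t ≡ᵇ t) ≡ false
suc-≡ᵇ-self zero    = refl
suc-≡ᵇ-self (suc t) = suc-≡ᵇ-self t

fin-≡ᵇ : ∀ {N} {a b : Fin N} → (toℕ a ≡ᵇ toℕ b) ≡ true → a ≡ b
fin-≡ᵇ e = toℕ-injective (≡ᵇ-true⇒≡ _ _ e)

≡ᵇ-injective : ∀ {N M} (f : Fin N → Fin M) → (∀ {a b} → f a ≡ f b → a ≡ b) →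
               ∀ a b → (toℕ (f a) ≡ᵇ toℕ (f b)) ≡ (toℕ a ≡ᵇ toℕ b)
≡ᵇ-injective f f-injective a b =
  bool-ext (λ e → ≡⇒≡ᵇ-true (cong toℕ (f-injective (fin-≡ᵇ e))))
           (λ e → ≡⇒≡ᵇ-true (cong (λ x → toℕ (f x)) (fin-≡ᵇ e)))

-- Saturating conversion  t ↦ min t k  into Fin (suc k); it indexes the vertices of a page.
clamp : (k t : ℕ) → Fin (suc k)
clamp k       zero    = zero
clamp zero    (suc t) = zero
clamp (suc k) (suc t) = suc (clamp k t)

toℕ-clamp : ∀ k t → t ≤ k → toℕ (clamp k t) ≡ t
toℕ-clamp k       zero    _         = refl
toℕ-clamp (suc k) (suc t) (s≤s t≤k) = cong suc (toℕ-clamp k t t≤k)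

clamp-toℕ : ∀ k (j : Fin (suc k)) → clamp k (toℕ j) ≡ j
clamp-toℕ k       zero    = refl
clamp-toℕ (suc k) (suc j) = cong suc (clamp-toℕ k j)

sum-zero : ∀ {N} {h : Fin N → Bool} → (∀ i → h i ≡ false) → ∑[ i < N ] h i ≡ false
sum-zero {N} h≡0 = trans (sum-cong-≗ h≡0) (sum-replicate-zero N)

sum-indicator : ∀ {N} (i : Fin N) (h : Fin N → Bool) → ∑[ x < N ] ((toℕ i ≡ᵇ toℕ x) ∧ h x) ≡ h i
sum-indicator {suc N} zero    h = trans (cong (h zero xor_) (sum-zero {N} (λ _ → refl))) (xor-identityʳ (h zero))
sum-indicator {suc N} (suc i) h = sum-indicator i (λ x → h (suc x))

count : ∀ {N} → (Fin N → Bool) → ℕ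
count {zero}  S = zero
count {suc N} S = if S zero then suc (count (λ i → S (suc i))) else count (λ i → S (suc i))

count≤ : ∀ {N} (S : Fin N → Bool) → count S ≤ N
count≤ {zero}  S = z≤n
count≤ {suc N} S with S zero
... | true  = s≤s (count≤ (λ i → S (suc i)))
... | false = m≤n⇒m≤1+n (count≤ (λ i → S (suc i)))

≤⇒≮ᵇ : ∀ {c} N → c ≤ N → (N <ᵇ c) ≡ false
≤⇒≮ᵇ N       z≤n       = refl
≤⇒≮ᵇ (suc N) (s≤s c≤N) = ≤⇒≮ᵇ N c≤N

toℕ-punchIn-last : ∀ {N} (i : Fin N) → toℕ (punchIn (fromℕ N) i) ≡ toℕ i
toℕ-punchIn-last zero    = refl
toℕ-punchIn-last (suc i) = cong suc (toℕ-punchIn-last i)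

SortsFirst : ∀ {N} → (Fin N → Bool) → Permutation′ N → Set
SortsFirst S π = ∀ l → S l ≡ (toℕ (π ⟨$⟩ʳ l) <ᵇ count S)

-- Every Boolean vector can be sorted: a true head stays first, a false head goes last.
sort : ∀ N (S : Fin N → Bool) → Σ (Permutation′ N) (SortsFirst S)
sort zero    S = Perm.id , λ ()
sort (suc N) S with sort N (λ i → S (suc i)) | S zero in S₀
... | π , sorted | true  = lift₀ π , sorted′
  where
  sorted′ : ∀ l → S l ≡ (toℕ (lift₀ π ⟨$⟩ʳ l) <ᵇ suc (count (λ i → S (suc i))))
  sorted′ zero    = S₀
  sorted′ (suc l) = sorted l
... | π , sorted | false = insert zero (fromℕ N) π , sorted′
  where
  sorted′ : ∀ l → S l ≡ (toℕ (insert zero (fromℕ N) π ⟨$⟩ʳ l) <ᵇ count (λ i → S (suc i)))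
  sorted′ zero    rewrite toℕ-fromℕ N = trans S₀ (sym (≤⇒≮ᵇ N (count≤ (λ i → S (suc i)))))
  sorted′ (suc l) rewrite insert-punchIn zero (fromℕ N) π l | toℕ-punchIn-last (π ⟨$⟩ʳ l) = sorted l

segment-≤ : ∀ {N M} (π : Fin N → Fin M) → (∀ {a b} → π a ≡ π b → a ≡ b) →
            ∀ {i j} → i ≤ N → (∀ l → (toℕ l <ᵇ i) ≡ (toℕ (π l) <ᵇ j)) → i ≤ j
segment-≤ {N} π π-injective {i} {j} i≤N same-side = injective⇒≤ {f = h} h-injective
  where
  embed : Fin i → Fin N
  embed a = inject≤ a i≤N

  lands : ∀ a → toℕ (π (embed a)) < j
  lands a = <ᵇ⇒< _ _ (Equivalence.from T-≡ (trans (sym (same-side (embed a)))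
              (Equivalence.to T-≡ (<⇒<ᵇ (subst (_< i) (sym (toℕ-inject≤ a i≤N)) (toℕ<n a))))))

  h : Fin i → Fin j
  h a = fromℕ< (lands a)

  h-injective : ∀ {a b} → h a ≡ h b → a ≡ b
  h-injective {a} {b} ha≡hb = inject≤-injective i≤N i≤N a b (π-injective (toℕ-injective
    (trans (sym (toℕ-fromℕ< (lands a))) (trans (cong toℕ ha≡hb) (toℕ-fromℕ< (lands b))))))

pigeonhole : ∀ {A : Set} {p q x y z : A} → x ≡ p ⊎ x ≡ q → y ≡ p ⊎ y ≡ q → z ≡ p ⊎ z ≡ q →
             x ≡ y ⊎ x ≡ z ⊎ y ≡ z
pigeonhole (inj₁ x≡p) (inj₁ y≡p) _          = inj₁ (trans x≡p (sym y≡p))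
pigeonhole (inj₂ x≡q) (inj₂ y≡q) _          = inj₁ (trans x≡q (sym y≡q))
pigeonhole (inj₁ x≡p) (inj₂ _)   (inj₁ z≡p) = inj₂ (inj₁ (trans x≡p (sym z≡p)))
pigeonhole (inj₂ x≡q) (inj₁ _)   (inj₂ z≡q) = inj₂ (inj₁ (trans x≡q (sym z≡q)))
pigeonhole (inj₁ _)   (inj₂ y≡q) (inj₂ z≡q) = inj₂ (inj₂ (trans y≡q (sym z≡q)))
pigeonhole (inj₂ _)   (inj₁ y≡p) (inj₁ z≡p) = inj₂ (inj₂ (trans y≡p (sym z≡p)))

module _ {m n : ℕ} where

  eqV-sound : (a b : Vtx m n) → eqV a b ≡ true → a ≡ b
  eqV-sound vu      vu        _ = refl
  eqV-sound vv      vv        _ = refl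
  eqV-sound (w l j) (w l' j') e = cong₂ w (fin-≡ᵇ (proj₁ (∧-true e))) (fin-≡ᵇ (proj₂ (∧-true e)))
  eqV-sound vu      vv        ()
  eqV-sound vu      (w _ _)   ()
  eqV-sound vv      vu        ()
  eqV-sound vv      (w _ _)   ()
  eqV-sound (w _ _) vu        ()
  eqV-sound (w _ _) vv        ()

  adj-irrefl : (a : Vtx m n) → adj a a ≡ false
  adj-irrefl vu      = refl
  adj-irrefl vv      = refl
  adj-irrefl (w l j) rewrite suc-≡ᵇ-self (toℕ j) = ∧-zeroʳ (toℕ l ≡ᵇ toℕ l)

  adj⇒≢ : {a b : Vtx m n} → adj a b ≡ true → a ≢ b
  adj⇒≢ {a} e refl = true≢false (trans (sym e) (adj-irrefl a))

  adj-sym : (a b : Vtx m n) → adj a b ≡ adj b a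
  adj-sym vu      vu        = refl
  adj-sym vu      vv        = refl
  adj-sym vu      (w _ _)   = refl
  adj-sym vv      vu        = refl
  adj-sym vv      vv        = refl
  adj-sym vv      (w _ _)   = refl
  adj-sym (w _ _) vu        = refl
  adj-sym (w _ _) vv        = refl
  adj-sym (w l j) (w l' j') =
    cong₂ _∧_ (≡ᵇ-sym (toℕ l) (toℕ l')) (∨-comm (suc (toℕ j) ≡ᵇ toℕ j') (suc (toℕ j') ≡ᵇ toℕ j))

  vanishes-off-edges : (σ : SigFun m n) → (∀ x y → σ x y ≡ true → adj x y ≡ true) →
                       ∀ a b → adj a b ≡ false → σ a b ≡ false
  vanishes-off-edges σ supp a b non-adj with σ a b in e
  ... | false = refl
  ... | true  = ⊥-elim (true≢false (trans (sym (supp a b e)) non-adj))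

  -- Pointwise equality of signatures (there is no function extensionality).
  infix 4 _≐_
  _≐_ : SigFun m n → SigFun m n → Set
  σ ≐ τ = ∀ a b → σ a b ≡ τ a b

  switchBy : (Vtx m n → Bool) → SigFun m n → SigFun m n
  switchBy p σ a b = σ a b xor (adj a b ∧ (p a xor p b))

  -- Switching equivalence only sees the target pointwise
  -- (an empty sequence is replaced by two switchings at u that cancel).
  switchEquiv-≐ : ∀ {σ τ τ'} → SwitchEquiv σ τ → τ ≐ τ' → SwitchEquiv σ τ'
  switchEquiv-≐ {σ} ε σ≐τ' =
    (vu , λ _ _ → refl) ◅ (vu , λ a b → trans (sym (σ≐τ' a b)) (sym (xor-cancelʳ (σ a b) _))) ◅ ε
  switchEquiv-≐ ((x , step) ◅ ε) τ≐τ' = (x , λ a b → trans (sym (τ≐τ' a b)) (step a b)) ◅ ε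
  switchEquiv-≐ (step ◅ steps@(_ ◅ _)) τ≐τ' = step ◅ switchEquiv-≐ steps τ≐τ'

  switchAt-as-switchBy : ∀ x σ → switchAt x σ ≐ switchBy (λ a → eqV a x) σ
  switchAt-as-switchBy x σ a b with adj a b in e
  ... | false = refl
  ... | true  = cong (σ a b xor_) (∨-as-xor (eqV a x) (eqV b x) λ ea eb →
                  adj⇒≢ e (trans (eqV-sound a x ea) (sym (eqV-sound b x eb))))

  switchBy-cong : ∀ {p q} σ → (∀ a → p a ≡ q a) → switchBy p σ ≐ switchBy q σ
  switchBy-cong σ p≡q a b = cong₂ (λ x y → σ a b xor (adj a b ∧ (x xor y))) (p≡q a) (p≡q b)

  switchBy-cong-sig : ∀ p {σ τ} → σ ≐ τ → switchBy p σ ≐ switchBy p τ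
  switchBy-cong-sig p σ≐τ a b = cong (_xor (adj a b ∧ (p a xor p b))) (σ≐τ a b)

  switchBy-zero : ∀ σ → switchBy (λ _ → false) σ ≐ σ
  switchBy-zero σ a b = trans (cong (σ a b xor_) (∧-zeroʳ (adj a b))) (xor-identityʳ (σ a b))

  switchBy-compose : ∀ p q σ → switchBy p (switchBy q σ) ≐ switchBy (λ a → p a xor q a) σ
  switchBy-compose p q σ a b = begin
      (σ a b xor (A ∧ (q a xor q b))) xor (A ∧ (p a xor p b))
    ≡⟨ xor-assoc (σ a b) _ _ ⟩
      σ a b xor ((A ∧ (q a xor q b)) xor (A ∧ (p a xor p b)))
    ≡⟨ cong (σ a b xor_) (xor-comm (A ∧ (q a xor q b)) _) ⟩
      σ a b xor ((A ∧ (p a xor p b)) xor (A ∧ (q a xor q b)))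
    ≡⟨ cong (σ a b xor_) (sym (∧-distribˡ-xor A _ _)) ⟩
      σ a b xor (A ∧ ((p a xor p b) xor (q a xor q b)))
    ≡⟨ cong (λ d → σ a b xor (A ∧ d)) (interchange (p a) (p b) (q a) (q b)) ⟩
      σ a b xor (A ∧ ((p a xor q a) xor (p b xor q b)))
    ∎
    where
    A = adj a b

  switchBy-involutive : ∀ p σ → switchBy p (switchBy p σ) ≐ σ
  switchBy-involutive p σ a b =
    trans (switchBy-compose p p σ a b)
          (trans (switchBy-cong σ (λ x → xor-same (p x)) a b) (switchBy-zero σ a b))

  switchBy-sym : ∀ p {σ} → (∀ x y → σ x y ≡ σ y x) → ∀ a b → switchBy p σ a b ≡ switchBy p σ b a
  switchBy-sym p {σ} σ-sym a b =
    cong₂ _xor_ (σ-sym a b) (cong₂ _∧_ (adj-sym a b) (xor-comm (p a) (p b)))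

  record Reachable (p : Vtx m n → Bool) : Set where
    constructor reachable
    field reach : ∀ σ → SwitchEquiv σ (switchBy p σ)
  open Reachable public

  reachable-resp : ∀ {p q} → (∀ a → p a ≡ q a) → Reachable p → Reachable q
  reachable-resp p≡q r = reachable λ σ → switchEquiv-≐ (reach r σ) (switchBy-cong σ p≡q)

  reachable-zero : Reachable (λ _ → false)
  reachable-zero = reachable λ σ → switchEquiv-≐ ε (λ a b → sym (switchBy-zero σ a b))

  reachable-point : ∀ x → Reachable (λ a → eqV a x)
  reachable-point x = reachable λ σ → (x , λ a b → sym (switchAt-as-switchBy x σ a b)) ◅ ε

  reachable-xor : ∀ {p q} → Reachable p → Reachable q → Reachable (λ a → p a xor q a)
  reachable-xor {p} {q} rp rq = reachable λ σ →
    switchEquiv-≐ (reach rq σ ◅◅ reach rp (switchBy q σ)) (switchBy-compose p q σ)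

  reachable-scale : ∀ {p} b → Reachable p → Reachable (λ a → p a ∧ b)
  reachable-scale {p} false _  = reachable-resp (λ a → sym (∧-zeroʳ (p a))) reachable-zero
  reachable-scale {p} true  rp = reachable-resp (λ a → sym (∧-identityʳ (p a))) rp

  reachable-sum : ∀ N {q : Fin N → Vtx m n → Bool} → (∀ i → Reachable (q i)) →
                  Reachable (λ a → ∑[ i < N ] q i a)
  reachable-sum zero    _  = reachable-zero
  reachable-sum (suc N) rq = reachable-xor (rq zero) (reachable-sum N (λ i → rq (suc i)))

  vertexSum : (Vtx m n → Bool) → Bool
  vertexSum h = h vu xor (h vv xor ∑[ l < n ] ∑[ j < m ∸ 2 ] h (w l j))

  reachable-vertexSum : ∀ {q : Vtx m n → Vtx m n → Bool} → (∀ x → Reachable (q x)) →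
                        Reachable (λ a → vertexSum (λ x → q x a))
  reachable-vertexSum rq =
    reachable-xor (rq vu) (reachable-xor (rq vv)
      (reachable-sum n (λ l → reachable-sum (m ∸ 2) (λ j → rq (w l j)))))

  point-expansion : ∀ (p : Vtx m n → Bool) a → vertexSum (λ x → eqV a x ∧ p x) ≡ p a
  point-expansion p vu =
    trans (cong (p vu xor_) (sum-zero {n} (λ l → sum-zero {m ∸ 2} (λ j → refl)))) (xor-identityʳ (p vu))
  point-expansion p vv =
    trans (cong (p vv xor_) (sum-zero {n} (λ l → sum-zero {m ∸ 2} (λ j → refl)))) (xor-identityʳ (p vv))
  point-expansion p (w l₀ j₀) = begin
      ∑[ l < n ] ∑[ j < m ∸ 2 ] (((toℕ l₀ ≡ᵇ toℕ l) ∧ (toℕ j₀ ≡ᵇ toℕ j)) ∧ p (w l j))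
    ≡⟨ sum-cong-≗ (λ l → sum-cong-≗ (λ j → ∧-assoc (toℕ l₀ ≡ᵇ toℕ l) (toℕ j₀ ≡ᵇ toℕ j) (p (w l j)))) ⟩
      ∑[ l < n ] ∑[ j < m ∸ 2 ] ((toℕ l₀ ≡ᵇ toℕ l) ∧ ((toℕ j₀ ≡ᵇ toℕ j) ∧ p (w l j)))
    ≡⟨ sum-cong-≗ (λ l → sym (*-distribˡ-sum (toℕ l₀ ≡ᵇ toℕ l) (λ j → (toℕ j₀ ≡ᵇ toℕ j) ∧ p (w l j)))) ⟩
      ∑[ l < n ] ((toℕ l₀ ≡ᵇ toℕ l) ∧ ∑[ j < m ∸ 2 ] ((toℕ j₀ ≡ᵇ toℕ j) ∧ p (w l j)))
    ≡⟨ sum-cong-≗ (λ l → cong ((toℕ l₀ ≡ᵇ toℕ l) ∧_) (sum-indicator j₀ (λ j → p (w l j)))) ⟩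
      ∑[ l < n ] ((toℕ l₀ ≡ᵇ toℕ l) ∧ p (w l j₀))
    ≡⟨ sum-indicator l₀ (λ l → p (w l j₀)) ⟩
      p (w l₀ j₀)
    ∎

  every-potential-reachable : ∀ p → Reachable p
  every-potential-reachable p =
    reachable-resp (point-expansion p)
      (reachable-vertexSum (λ x → reachable-scale {λ a → eqV a x} (p x) (reachable-point x)))

  parity : SigFun m n → Vtx m n → List (Vtx m n) → Bool
  parity σ a []       = false
  parity σ a (b ∷ bs) = σ a b xor parity σ b bs

  endpoint : Vtx m n → List (Vtx m n) → Vtx m n
  endpoint a []       = a
  endpoint a (b ∷ bs) = endpoint b bs

  IsWalk : Vtx m n → List (Vtx m n) → Set
  IsWalk a []       = ⊤
  IsWalk a (b ∷ bs) = adj a b ≡ true × IsWalk b bs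

  IsClosedWalk : Vtx m n → List (Vtx m n) → Set
  IsClosedWalk a xs = IsWalk a xs × endpoint a xs ≡ a

  endpoint-snoc : ∀ a xs b → endpoint a (xs ++ b ∷ []) ≡ b
  endpoint-snoc a []       b = refl
  endpoint-snoc a (x ∷ xs) b = endpoint-snoc x xs b

  endpoint-map : ∀ (f : Vtx m n → Vtx m n) a xs → endpoint (f a) (map f xs) ≡ f (endpoint a xs)
  endpoint-map f a []       = refl
  endpoint-map f a (b ∷ bs) = endpoint-map f b bs

  parity-≐ : ∀ {σ τ} → σ ≐ τ → ∀ a xs → parity σ a xs ≡ parity τ a xs
  parity-≐ σ≐τ a []       = refl
  parity-≐ σ≐τ a (b ∷ bs) = cong₂ _xor_ (σ≐τ a b) (parity-≐ σ≐τ b bs)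

  parity-switchBy : ∀ p σ a xs → IsWalk a xs →
                    parity (switchBy p σ) a xs ≡ parity σ a xs xor (p a xor p (endpoint a xs))
  parity-switchBy p σ a []       _ = sym (xor-same (p a))
  parity-switchBy p σ a (b ∷ bs) (a~b , walk) rewrite a~b | parity-switchBy p σ b bs walk =
    trans (interchange (σ a b) (p a xor p b) (parity σ b bs) _)
          (cong (parity σ a (b ∷ bs) xor_) (xor-telescope (p a) (p b) (p (endpoint b bs))))

  parity-switchEquiv : ∀ {σ τ} → SwitchEquiv σ τ → ∀ {a xs} → IsClosedWalk a xs →
                       parity σ a xs ≡ parity τ a xs
  parity-switchEquiv ε _ = refl
  parity-switchEquiv {σ} ((x , step) ◅ steps) {a} {xs} (walk , closed) =
    trans (sym one-switch) (parity-switchEquiv steps (walk , closed))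
    where
    one-switch : parity _ a xs ≡ parity σ a xs
    one-switch = begin
        parity _ a xs
      ≡⟨ parity-≐ (λ a b → trans (step a b) (switchAt-as-switchBy x σ a b)) a xs ⟩
        parity (switchBy (λ z → eqV z x) σ) a xs
      ≡⟨ parity-switchBy (λ z → eqV z x) σ a xs walk ⟩
        parity σ a xs xor (eqV a x xor eqV (endpoint a xs) x)
      ≡⟨ cong (λ e → parity σ a xs xor (eqV a x xor eqV e x)) closed ⟩
        parity σ a xs xor (eqV a x xor eqV a x)
      ≡⟨ cong (parity σ a xs xor_) (xor-same (eqV a x)) ⟩
        parity σ a xs xor false
      ≡⟨ xor-identityʳ (parity σ a xs) ⟩
        parity σ a xs
      ∎

  parity-map : ∀ {σ τ} (f : Vtx m n → Vtx m n) → (∀ x y → σ x y ≡ τ (f x) (f y)) →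
               ∀ a xs → parity σ a xs ≡ parity τ (f a) (map f xs)
  parity-map f σ≡τf a []       = refl
  parity-map f σ≡τf a (b ∷ bs) = cong₂ _xor_ (σ≡τf a b) (parity-map f σ≡τf b bs)

  closedWalk-map : ∀ (f : Vtx m n → Vtx m n) → (∀ x y → adj (f x) (f y) ≡ adj x y) →
                   ∀ {a xs} → IsClosedWalk a xs → IsClosedWalk (f a) (map f xs)
  closedWalk-map f adj-f {a} {xs} (walk , closed) =
    walk-map a xs walk , trans (endpoint-map f a xs) (cong f closed)
    where
    walk-map : ∀ a xs → IsWalk a xs → IsWalk (f a) (map f xs)
    walk-map a []       _            = tt
    walk-map a (b ∷ bs) (a~b , walk) = trans (adj-f a b) a~b , walk-map b bs walk

  parity-switchIso : ∀ {σ τ σ'} (f : Vtx m n → Vtx m n) → SwitchEquiv τ σ' →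
                     (∀ x y → adj (f x) (f y) ≡ adj x y) → (∀ x y → σ x y ≡ σ' (f x) (f y)) →
                     ∀ {a xs} → IsClosedWalk a xs → parity σ a xs ≡ parity τ (f a) (map f xs)
  parity-switchIso f τ~σ' adj-f σ≡σ'f {a} {xs} closed =
    trans (parity-map f σ≡σ'f a xs) (sym (parity-switchEquiv τ~σ' (closedWalk-map f adj-f closed)))

  inverse-preserves-adj : ∀ (f g : Vtx m n → Vtx m n) → (∀ x → f (g x) ≡ x) →
                          (∀ x y → adj (f x) (f y) ≡ adj x y) → ∀ x y → adj (g x) (g y) ≡ adj x y
  inverse-preserves-adj f g fg adj-f x y = trans (sym (adj-f (g x) (g y))) (cong₂ adj (fg x) (fg y))

  switchBy-transport : ∀ {σ} τ (f g : Vtx m n → Vtx m n) → (∀ x → g (f x) ≡ x) →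
                       (∀ x y → adj (f x) (f y) ≡ adj x y) → (∀ x y → σ x y ≡ τ (f x) (f y)) →
                       ∀ p x y → switchBy p σ x y ≡ switchBy (λ z → p (g z)) τ (f x) (f y)
  switchBy-transport τ f g gf adj-f σ≡τf p x y rewrite gf x | gf y | adj-f x y | σ≡τf x y = refl

-- The Book graph B(k+3, n): every page has k+1 interior vertices.

module Book (k n : ℕ) where

  V : Set
  V = Vtx (suc (suc (suc k))) n

  Sig : Set
  Sig = SigFun (suc (suc (suc k))) n

  u≢v : _≢_ {A = V} vu vv
  u≢v ()

  -- The t-th interior vertex of page l (saturating at the top vertex, t = k).
  page : Fin n → ℕ → V
  page l t = w l (clamp k t)

  below : Fin n → ℕ → List V
  below l zero    = []
  below l (suc t) = page l t ∷ below l t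

  cycle : Fin n → List V
  cycle l = vv ∷ page l k ∷ (below l k ++ vu ∷ [])

  isTop : Fin (suc k) → Bool
  isTop j = suc (toℕ j) ≡ᵇ suc k

  top-index : ∀ {j : Fin (suc k)} → isTop j ≡ true → j ≡ clamp k k
  top-index {j} e = trans (sym (clamp-toℕ k j)) (cong (clamp k) (suc-injective (≡ᵇ-true⇒≡ _ _ e)))

  page-step : ∀ l t → suc t ≤ k → adj (page l (suc t)) (page l t) ≡ true
  page-step l t t<k
    rewrite toℕ-clamp k (suc t) t<k | toℕ-clamp k t (≤-trans (n≤1+n t) t<k)
          | ≡ᵇ-refl (toℕ l) | ≡ᵇ-refl t = ∨-zeroʳ (suc (suc t) ≡ᵇ t)

  page-top : ∀ l → adj (page l k) vv ≡ true
  page-top l rewrite toℕ-clamp k k ≤-refl = ≡ᵇ-refl k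

  below-walk : ∀ l t → t ≤ k → IsWalk (page l t) (below l t ++ vu ∷ [])
  below-walk l zero    _   = refl , tt
  below-walk l (suc t) t<k = page-step l t t<k , below-walk l t (≤-trans (n≤1+n t) t<k)

  below-endpoint : ∀ l t → endpoint (page l t) (below l t) ≡ page l 0
  below-endpoint l zero    = refl
  below-endpoint l (suc t) = below-endpoint l t

  cycle-closed : ∀ l → IsClosedWalk vu (cycle l)
  cycle-closed l = (refl , page-top l , below-walk l k ≤-refl) , endpoint-snoc (page l k) (below l k) vu

  Interior : V → Set
  Interior (w _ _) = ⊤
  Interior _       = ⊥

  below-interior : ∀ l t → All Interior (below l t)
  below-interior l zero    = []
  below-interior l (suc t) = tt ∷ below-interior l t

  canonical : (Fin n → Bool) → Sig
  canonical S (w l j) vv      = S l ∧ isTop j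
  canonical S vv      (w l j) = S l ∧ isTop j
  canonical S _       _       = false

  canonical-sym : ∀ S a b → canonical S a b ≡ canonical S b a
  canonical-sym S vu      vu      = refl
  canonical-sym S vu      vv      = refl
  canonical-sym S vu      (w _ _) = refl
  canonical-sym S vv      vu      = refl
  canonical-sym S vv      vv      = refl
  canonical-sym S vv      (w _ _) = refl
  canonical-sym S (w _ _) vu      = refl
  canonical-sym S (w _ _) vv      = refl
  canonical-sym S (w _ _) (w _ _) = refl

  canonical-signature : ∀ S → IsSignature (canonical S)
  canonical-signature S = canonical-sym S , support
    where
    support : ∀ a b → canonical S a b ≡ true → adj a b ≡ true
    support vv      (w l j) e = proj₂ (∧-true {S l} e)
    support (w l j) vv      e = proj₂ (∧-true {S l} e)
    support vu      _       ()
    support vv      vu      ()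
    support vv      vv      ()
    support (w _ _) vu      ()
    support (w _ _) (w _ _) ()

  canonical-to-u : ∀ S x → canonical S x vu ≡ false
  canonical-to-u S vu      = refl
  canonical-to-u S vv      = refl
  canonical-to-u S (w _ _) = refl

  parity-canonical-interior : ∀ S y ys z → Interior y → All Interior ys →
                              parity (canonical S) y (ys ++ z ∷ []) ≡ canonical S (endpoint y ys) z
  parity-canonical-interior S (w _ _) []               z _ _          = xor-identityʳ _
  parity-canonical-interior S (w _ _) (y@(w _ _) ∷ ys) z _ (_ ∷ ys-int) =
    parity-canonical-interior S y ys z tt ys-int

  parity-cycle : ∀ S l → parity (canonical S) vu (cycle l) ≡ S l
  parity-cycle S l
    rewrite parity-canonical-interior S (page l k) (below l k) vu tt (below-interior l k)
          | canonical-to-u S (endpoint (page l k) (below l k)) | page-top l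
    = trans (xor-identityʳ (S l ∧ true)) (∧-identityʳ (S l))

  module CanonicalForm (σ : Sig) (σ-sym : ∀ x y → σ x y ≡ σ y x)
                       (σ-supp : ∀ x y → σ x y ≡ true → adj x y ≡ true) where

    -- Parity of the path u u_0ˡ … u_tˡ.
    pagePotential : Fin n → ℕ → Bool
    pagePotential l zero    = σ vu (page l zero)
    pagePotential l (suc t) = pagePotential l t xor σ (page l t) (page l (suc t))

    -- Parity of the tree path from u (the tree is uv plus the paths u u_0ˡ … u_kˡ).
    treePotential : V → Bool
    treePotential vu      = false
    treePotential vv      = σ vu vv
    treePotential (w l j) = pagePotential l (toℕ j)

    negativePages : Fin n → Bool
    negativePages l = switchBy treePotential σ (page l k) vv

    tree-edge : ∀ a b → adj a b ≡ true → treePotential b ≡ treePotential a xor σ a b →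
                switchBy treePotential σ a b ≡ false
    tree-edge a b a~b pot-b rewrite a~b | pot-b =
      trans (cong (σ a b xor_) (xor-cancelˡ (treePotential a) (σ a b))) (xor-same (σ a b))

    tree-step : ∀ l (j j' : Fin (suc k)) → toℕ j' ≡ suc (toℕ j) →
                treePotential (w l j') ≡ treePotential (w l j) xor σ (w l j) (w l j')
    tree-step l j j' j'≡1+j rewrite j'≡1+j =
      cong₂ (λ x y → pagePotential l (toℕ j) xor σ (w l x) (w l y))
            (clamp-toℕ k j) (trans (cong (clamp k) (sym j'≡1+j)) (clamp-toℕ k j'))

    -- The non-tree edges are the top edges; their new signs are the negative pages.
    top-edge : ∀ l j → j ≡ clamp k k → switchBy treePotential σ (w l j) vv ≡ negativePages l ∧ isTop j
    top-edge l _ refl = sym (trans (cong (negativePages l ∧_) (page-top l)) (∧-identityʳ _))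

    by-symmetry : ∀ a b → switchBy treePotential σ b a ≡ canonical negativePages b a →
                  switchBy treePotential σ a b ≡ canonical negativePages a b
    by-symmetry a b eq =
      trans (switchBy-sym treePotential σ-sym a b) (trans eq (canonical-sym negativePages b a))

    canonical-edge : ∀ a b → adj a b ≡ true → switchBy treePotential σ a b ≡ canonical negativePages a b
    canonical-edge vu            vu            ()
    canonical-edge vv            vv            ()
    canonical-edge vu            vv            e = tree-edge vu vv e refl
    canonical-edge vv            vu            e = by-symmetry vv vu (tree-edge vu vv refl refl)
    canonical-edge vu            (w l zero)    e = tree-edge vu (w l zero) e refl
    canonical-edge vu            (w l (suc j)) ()
    canonical-edge (w l zero)    vu            e = by-symmetry (w l zero) vu (tree-edge vu (w l zero) refl refl)
    canonical-edge (w l (suc j)) vu            ()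
    canonical-edge (w l j)       vv            e = top-edge l j (top-index e)
    canonical-edge vv            (w l j)       e = by-symmetry vv (w l j) (top-edge l j (top-index e))
    canonical-edge (w l j)       (w l' j')     e with fin-≡ᵇ {a = l} {l'} (proj₁ (∧-true e))
    ... | refl with ∨-true (proj₂ (∧-true {toℕ l ≡ᵇ toℕ l} e))
    ...   | inj₁ up   = tree-edge (w l j) (w l j') e (tree-step l j j' (sym (≡ᵇ-true⇒≡ _ _ up)))
    ...   | inj₂ down = by-symmetry (w l j) (w l j')
                          (tree-edge (w l j') (w l j) (trans (adj-sym {suc (suc (suc k))} (w l j') (w l j)) e)
                            (tree-step l j' j (sym (≡ᵇ-true⇒≡ _ _ down))))

    canonical-form : switchBy treePotential σ ≐ canonical negativePages
    canonical-form a b with true-or-false (adj a b)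
    ... | inj₁ a~b = canonical-edge a b a~b
    ... | inj₂ a≁b rewrite a≁b =
      trans (cong (_xor false) (vanishes-off-edges σ σ-supp a b a≁b))
            (sym (vanishes-off-edges (canonical negativePages)
                   (proj₂ (canonical-signature negativePages)) a b a≁b))

  relabel : (Fin n → Fin n) → V → V
  relabel π vu      = vu
  relabel π vv      = vv
  relabel π (w l j) = w (π l) j

  relabel-automorphism : (π : Permutation′ n) → IsAutomorphism (relabel (π ⟨$⟩ʳ_))
  relabel-automorphism π = (relabel (π ⟨$⟩ˡ_) , right-inverse , left-inverse) , adj-relabel
    where
    right-inverse : ∀ x → relabel (π ⟨$⟩ʳ_) (relabel (π ⟨$⟩ˡ_) x) ≡ x
    right-inverse vu      = refl
    right-inverse vv      = refl
    right-inverse (w l j) = cong (λ l' → w l' j) (inverseʳ π)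

    left-inverse : ∀ x → relabel (π ⟨$⟩ˡ_) (relabel (π ⟨$⟩ʳ_) x) ≡ x
    left-inverse vu      = refl
    left-inverse vv      = refl
    left-inverse (w l j) = cong (λ l' → w l' j) (inverseˡ π)

    π-injective : ∀ {a b} → π ⟨$⟩ʳ a ≡ π ⟨$⟩ʳ b → a ≡ b
    π-injective e = trans (sym (inverseˡ π)) (trans (cong (π ⟨$⟩ˡ_) e) (inverseˡ π))

    adj-relabel : ∀ x y → adj (relabel (π ⟨$⟩ʳ_) x) (relabel (π ⟨$⟩ʳ_) y) ≡ adj x y
    adj-relabel vu      vu        = refl
    adj-relabel vu      vv        = refl
    adj-relabel vu      (w _ _)   = refl
    adj-relabel vv      vu        = refl
    adj-relabel vv      vv        = refl
    adj-relabel vv      (w _ _)   = refl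
    adj-relabel (w _ _) vu        = refl
    adj-relabel (w _ _) vv        = refl
    adj-relabel (w l j) (w l' j') =
      cong (_∧ ((suc (toℕ j) ≡ᵇ toℕ j') ∨ (suc (toℕ j') ≡ᵇ toℕ j)))
           (≡ᵇ-injective (π ⟨$⟩ʳ_) π-injective l l')

  canonical-relabel : ∀ (π : Fin n → Fin n) S T → (∀ l → S l ≡ T (π l)) →
                      ∀ x y → canonical S x y ≡ canonical T (relabel π x) (relabel π y)
  canonical-relabel π S T S≡Tπ (w l j) vv      = cong (_∧ isTop j) (S≡Tπ l)
  canonical-relabel π S T S≡Tπ vv      (w l j) = cong (_∧ isTop j) (S≡Tπ l)
  canonical-relabel π S T S≡Tπ vu      _       = refl
  canonical-relabel π S T S≡Tπ vv      vu      = refl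
  canonical-relabel π S T S≡Tπ vv      vv      = refl
  canonical-relabel π S T S≡Tπ (w _ _) vu      = refl
  canonical-relabel π S T S≡Tπ (w _ _) (w _ _) = refl

  representative : Fin (suc n) → Sig
  representative i = canonical (λ l → toℕ l <ᵇ toℕ i)

  parity-representative : ∀ i l → parity (representative i) vu (cycle l) ≡ (toℕ l <ᵇ toℕ i)
  parity-representative i = parity-cycle (λ l → toℕ l <ᵇ toℕ i)

  -- Covering: switch σ to canonical form, then sort its negative pages to the front.
  every-signature-covered : ∀ σ → IsSignature σ → ∃ λ i → SwitchIso σ (representative i)
  every-signature-covered σ (σ-sym , σ-supp) =
    i , σ' , reach (every-potential-reachable p) (representative i) , F , aut , iso
    where
    open CanonicalForm σ σ-sym σ-supp
    π : Permutation′ n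
    π = proj₁ (sort n negativePages)
    i : Fin (suc n)
    i = fromℕ< (s≤s (count≤ negativePages))
    F G : V → V
    F = relabel (π ⟨$⟩ʳ_)
    G = relabel (π ⟨$⟩ˡ_)
    aut : IsAutomorphism F
    aut = relabel-automorphism π
    p : V → Bool
    p z = treePotential (G z)
    σ' : Sig
    σ' = switchBy p (representative i)
    relabelled : ∀ x y → canonical negativePages x y ≡ representative i (F x) (F y)
    relabelled = canonical-relabel (π ⟨$⟩ʳ_) negativePages _ λ l →
      trans (proj₂ (sort n negativePages) l)
            (cong (toℕ (π ⟨$⟩ʳ l) <ᵇ_) (sym (toℕ-fromℕ< (s≤s (count≤ negativePages)))))
    iso : ∀ x y → σ x y ≡ σ' (F x) (F y)
    iso x y = begin
        σ x y
      ≡⟨ sym (switchBy-involutive treePotential σ x y) ⟩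
        switchBy treePotential (switchBy treePotential σ) x y
      ≡⟨ switchBy-cong-sig treePotential canonical-form x y ⟩
        switchBy treePotential (canonical negativePages) x y
      ≡⟨ switchBy-transport (representative i) F G (proj₂ (proj₂ (proj₁ aut))) (proj₂ aut) relabelled treePotential x y ⟩
        σ' (F x) (F y)
      ∎

  representative-zero : ∀ x y → representative zero x y ≡ false
  representative-zero vu      _       = refl
  representative-zero vv      vu      = refl
  representative-zero vv      vv      = refl
  representative-zero vv      (w _ _) = refl
  representative-zero (w _ _) vu      = refl
  representative-zero (w _ _) vv      = refl
  representative-zero (w _ _) (w _ _) = refl

  parity-positive : ∀ a xs → parity {suc (suc (suc k))} {n} (λ _ _ → false) a xs ≡ false
  parity-positive a []       = refl
  parity-positive a (b ∷ bs) = parity-positive b bs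

  iso-from-zero : ∀ {j} → SwitchIso (representative zero) (representative j) → ∀ l → (toℕ l <ᵇ toℕ j) ≡ false
  iso-from-zero {j} (σ' , rep-j~σ' , _ , ((g , fg , _) , _) , rep₀≡σ'f) l = begin
      toℕ l <ᵇ toℕ j
    ≡⟨ sym (parity-representative j l) ⟩
      parity (representative j) vu (cycle l)
    ≡⟨ parity-switchEquiv rep-j~σ' (cycle-closed l) ⟩
      parity σ' vu (cycle l)
    ≡⟨ parity-≐ σ'-positive vu (cycle l) ⟩
      parity (λ _ _ → false) vu (cycle l)
    ≡⟨ parity-positive vu (cycle l) ⟩
      false
    ∎
    where
    σ'-positive : σ' ≐ λ _ _ → false
    σ'-positive a b = trans (sym (cong₂ σ' (fg a) (fg b)))
                            (trans (sym (rep₀≡σ'f (g a) (g b))) (representative-zero (g a) (g b)))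

  iso-to-zero : ∀ {i} → SwitchIso (representative i) (representative zero) → ∀ l → (toℕ l <ᵇ toℕ i) ≡ false
  iso-to-zero {i} (σ' , rep₀~σ' , f , (_ , adj-f) , rep-i≡σ'f) l = begin
      toℕ l <ᵇ toℕ i
    ≡⟨ sym (parity-representative i l) ⟩
      parity (representative i) vu (cycle l)
    ≡⟨ parity-switchIso f rep₀~σ' adj-f rep-i≡σ'f (cycle-closed l) ⟩
      parity (representative zero) (f vu) (map f (cycle l))
    ≡⟨ parity-≐ representative-zero (f vu) (map f (cycle l)) ⟩
      parity (λ _ _ → false) (f vu) (map f (cycle l))
    ≡⟨ parity-positive (f vu) (map f (cycle l)) ⟩
      false
    ∎

  -- Interior vertices have degree ≤ 2: their neighbours lie one level above or below.
  height : V → ℕ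
  height vu      = zero
  height vv      = suc (suc k)
  height (w l j) = suc (toℕ j)

  neighbour-height : ∀ l j a → adj (w l j) a ≡ true → height a ≡ suc (suc (toℕ j)) ⊎ height a ≡ toℕ j
  neighbour-height l j vu        e = inj₂ (sym (≡ᵇ-true⇒≡ _ _ e))
  neighbour-height l j vv        e = inj₁ (cong suc (sym (≡ᵇ-true⇒≡ _ _ e)))
  neighbour-height l j (w l' j') e with ∨-true (proj₂ (∧-true {toℕ l ≡ᵇ toℕ l'} e))
  ... | inj₁ up   = inj₁ (cong suc (sym (≡ᵇ-true⇒≡ _ _ up)))
  ... | inj₂ down = inj₂ (≡ᵇ-true⇒≡ _ _ down)

  neighbour-unique : ∀ l j a b → adj (w l j) a ≡ true → adj (w l j) b ≡ true → height a ≡ height b → a ≡ b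
  neighbour-unique l j vu        vu        _  _  _ = refl
  neighbour-unique l j vv        vv        _  _  _ = refl
  neighbour-unique l j vu        vv        _  _  ()
  neighbour-unique l j vv        vu        _  _  ()
  neighbour-unique l j vu        (w _ _)   _  _  ()
  neighbour-unique l j (w _ _)   vu        _  _  ()
  neighbour-unique l j vv        (w _ j')  _  _  h = ⊥-elim (<⇒≢ (toℕ<n j') (suc-injective (sym h)))
  neighbour-unique l j (w _ j')  vv        _  _  h = ⊥-elim (<⇒≢ (toℕ<n j') (suc-injective h))
  neighbour-unique l j (w l₁ j₁) (w l₂ j₂) e₁ e₂ h =
    cong₂ w (trans (sym (fin-≡ᵇ {a = l} (proj₁ (∧-true e₁)))) (fin-≡ᵇ {a = l} (proj₁ (∧-true e₂))))
            (toℕ-injective (suc-injective h))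

  interior-degree≤2 : ∀ x a b c → Interior x → adj x a ≡ true → adj x b ≡ true → adj x c ≡ true →
                      a ≢ b → a ≢ c → b ≢ c → ⊥
  interior-degree≤2 (w l j) a b c _ x~a x~b x~c a≢b a≢c b≢c
    with pigeonhole (neighbour-height l j a x~a) (neighbour-height l j b x~b) (neighbour-height l j c x~c)
  ... | inj₁ ha≡hb        = a≢b (neighbour-unique l j a b x~a x~b ha≡hb)
  ... | inj₂ (inj₁ ha≡hc) = a≢c (neighbour-unique l j a c x~a x~c ha≡hc)
  ... | inj₂ (inj₂ hb≡hc) = b≢c (neighbour-unique l j b c x~b x~c hb≡hc)

  OnPage : Fin n → V → Set
  OnPage l (w l' _) = l' ≡ l
  OnPage l _        = ⊥

  pageOf : ∀ x → Interior x → Fin n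
  pageOf (w l _) _ = l

  pageOf-onPage : ∀ x (x-int : Interior x) → OnPage (pageOf x x-int) x
  pageOf-onPage (w l _) _ = refl

  adjacent-same-page : ∀ {l x y} → adj x y ≡ true → OnPage l x → Interior y → OnPage l y
  adjacent-same-page {x = w l j} {w l' j'} e refl _ = sym (fin-≡ᵇ {a = l} (proj₁ (∧-true e)))

  canonical-into-v : ∀ S {l x} → OnPage l x → canonical S x vv ≡ S l ∧ adj x vv
  canonical-into-v S {x = w _ _} refl = refl

  canonical-from-v : ∀ S {l x} → OnPage l x → canonical S vv x ≡ S l ∧ adj x vv
  canonical-from-v S {x = w _ _} refl = refl

  -- With at least two pages, u and v are the vertices of degree ≥ 3, so every
  -- adjacency-preserving injection maps them to non-interior vertices.
  module TwoPages (p₀ p₁ : Fin n) (p₀≢p₁ : p₀ ≢ p₁) where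

    hubs-preserved : ∀ (h : V → V) → (∀ {a b} → h a ≡ h b → a ≡ b) → (∀ x y → adj (h x) (h y) ≡ adj x y) →
                     ¬ Interior (h vu) × ¬ Interior (h vv)
    hubs-preserved h h-injective adj-h =
      (λ int → interior-degree≤2 (h vu) (h vv) (h (page p₀ 0)) (h (page p₁ 0)) int
                 (adj-h vu vv) (adj-h vu (page p₀ 0)) (adj-h vu (page p₁ 0))
                 (distinct λ ()) (distinct λ ()) (distinct on-pages)) ,
      (λ int → interior-degree≤2 (h vv) (h vu) (h (page p₀ k)) (h (page p₁ k)) int
                 (adj-h vv vu) (trans (adj-h vv (page p₀ k)) (page-top p₀))
                 (trans (adj-h vv (page p₁ k)) (page-top p₁))
                 (distinct λ ()) (distinct λ ()) (distinct on-pages))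
      where
      distinct : ∀ {a b} → a ≢ b → h a ≢ h b
      distinct a≢b ha≡hb = a≢b (h-injective ha≡hb)
      on-pages : ∀ {j j'} → _≢_ {A = V} (w p₀ j) (w p₁ j')
      on-pages refl = p₀≢p₁ refl

  module Automorphism (p₀ p₁ : Fin n) (p₀≢p₁ : p₀ ≢ p₁) (f g : V → V)
                      (fg : ∀ x → f (g x) ≡ x) (gf : ∀ x → g (f x) ≡ x)
                      (adj-f : ∀ x y → adj (f x) (f y) ≡ adj x y) where
    open TwoPages p₀ p₁ p₀≢p₁

    f-injective : ∀ {a b} → f a ≡ f b → a ≡ b
    f-injective {a} {b} fa≡fb = trans (sym (gf a)) (trans (cong g fa≡fb) (gf b))

    g-injective : ∀ {a b} → g a ≡ g b → a ≡ b
    g-injective {a} {b} ga≡gb = trans (sym (fg a)) (trans (cong f ga≡gb) (fg b))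

    -- f maps interior vertices to interior vertices, since g maps u and v to u or v.
    interior-preserved : ∀ {x} → Interior x → Interior (f x)
    interior-preserved {x} x-int with f x in fx
    ... | w _ _ = tt
    ... | vu    = proj₁ (hubs-preserved g g-injective (inverse-preserves-adj f g fg adj-f))
                    (subst Interior (sym (trans (cong g (sym fx)) (gf x))) x-int)
    ... | vv    = proj₂ (hubs-preserved g g-injective (inverse-preserves-adj f g fg adj-f))
                    (subst Interior (sym (trans (cong g (sym fx)) (gf x))) x-int)

    hubs-permuted : (f vu ≡ vu × f vv ≡ vv) ⊎ (f vu ≡ vv × f vv ≡ vu)
    hubs-permuted with f vu in fu | f vv in fv | hubs-preserved f f-injective adj-f
    ... | vu    | vv    | _        = inj₁ (refl , refl)
    ... | vv    | vu    | _        = inj₂ (refl , refl)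
    ... | vu    | vu    | _        = ⊥-elim (u≢v (f-injective (trans fu (sym fv))))
    ... | vv    | vv    | _        = ⊥-elim (u≢v (f-injective (trans fu (sym fv))))
    ... | w _ _ | _     | (¬u , _) = ⊥-elim (¬u tt)
    ... | vu    | w _ _ | (_ , ¬v) = ⊥-elim (¬v tt)
    ... | vv    | w _ _ | (_ , ¬v) = ⊥-elim (¬v tt)

    pageMap : Fin n → Fin n
    pageMap l = pageOf (f (page l 0)) (interior-preserved tt)

    -- f maps every vertex of page l onto page pageMap l (by connectivity of the page).
    page-preserved : ∀ l t → t ≤ k → OnPage (pageMap l) (f (page l t))
    page-preserved l zero    _   = pageOf-onPage (f (page l 0)) (interior-preserved tt)
    page-preserved l (suc t) t<k =
      adjacent-same-page (trans (adj-f (page l t) (page l (suc t)))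
                                (trans (adj-sym (page l t) (page l (suc t))) (page-step l t t<k)))
                         (page-preserved l t (≤-trans (n≤1+n t) t<k)) (interior-preserved tt)

    onPage-preserved : ∀ {l x} → OnPage l x → OnPage (pageMap l) (f x)
    onPage-preserved {l} {w _ j} refl =
      subst (λ i → OnPage (pageMap l) (f (w l i))) (clamp-toℕ k j) (page-preserved l (toℕ j) (toℕ≤pred[n] j))

    pageMap-inverse : ∀ (π : Fin n → Fin n) → (∀ {l x} → OnPage l x → OnPage (π l) (g x)) →
                      ∀ l → π (pageMap l) ≡ l
    pageMap-inverse π tracks l =
      sym (subst (OnPage (π (pageMap l))) (gf (page l 0)) (tracks (page-preserved l 0 z≤n)))

    image-interior : ∀ l → All Interior (map f (below l k))
    image-interior l = map⁺ (All.map interior-preserved (below-interior l k))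

    image-bottom : ∀ l → endpoint (f (page l k)) (map f (below l k)) ≡ f (page l 0)
    image-bottom l = trans (endpoint-map f (page l k) (below l k)) (cong f (below-endpoint l k))

    image-parity : ∀ S l → parity (canonical S) (f vu) (map f (cycle l)) ≡ S (pageMap l)
    image-parity S l rewrite map-++ f (below l k) (vu ∷ []) with hubs-permuted
    ... | inj₁ (fu , fv) rewrite fu | fv = begin
        canonical S vv (f (page l k)) xor parity (canonical S) (f (page l k)) (map f (below l k) ++ vu ∷ [])
      ≡⟨ cong₂ _xor_ (canonical-from-v S (page-preserved l k ≤-refl))
                     (parity-canonical-interior S _ _ vu (interior-preserved tt) (image-interior l)) ⟩
        (S (pageMap l) ∧ adj (f (page l k)) vv) xor canonical S (endpoint (f (page l k)) (map f (below l k))) vu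
      ≡⟨ cong₂ (λ a b → (S (pageMap l) ∧ a) xor b)
               (trans (cong (adj (f (page l k))) (sym fv)) (trans (adj-f (page l k) vv) (page-top l)))
               (canonical-to-u S (endpoint (f (page l k)) (map f (below l k)))) ⟩
        (S (pageMap l) ∧ true) xor false
      ≡⟨ trans (xor-identityʳ _) (∧-identityʳ _) ⟩
        S (pageMap l)
      ∎
    ... | inj₂ (fu , fv) rewrite fu | fv = begin
        parity (canonical S) (f (page l k)) (map f (below l k) ++ vv ∷ [])
      ≡⟨ parity-canonical-interior S _ _ vv (interior-preserved tt) (image-interior l) ⟩
        canonical S (endpoint (f (page l k)) (map f (below l k))) vv
      ≡⟨ cong (λ x → canonical S x vv) (image-bottom l) ⟩
        canonical S (f (page l 0)) vv
      ≡⟨ canonical-into-v S (page-preserved l 0 z≤n) ⟩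
        S (pageMap l) ∧ adj (f (page l 0)) vv
      ≡⟨ cong (S (pageMap l) ∧_) (trans (cong (adj (f (page l 0))) (sym fu)) (adj-f (page l 0) vu)) ⟩
        S (pageMap l) ∧ true
      ≡⟨ ∧-identityʳ _ ⟩
        S (pageMap l)
      ∎

  -- With two pages, the representatives are pairwise non-isomorphic: the induced page
  -- permutation matches negative pages of rep i with negative pages of rep j.
  representatives-distinct-two-pages : (p₀ p₁ : Fin n) → p₀ ≢ p₁ →
    ∀ i j → SwitchIso (representative i) (representative j) → i ≡ j
  representatives-distinct-two-pages p₀ p₁ p₀≢p₁ i j
    (σ' , rep-j~σ' , f , ((g , fg , gf) , adj-f) , rep-i≡σ'f) =
    toℕ-injective (≤-antisym (segment-≤ F.pageMap F-injective (toℕ≤pred[n] i) same-side)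
                             (segment-≤ G.pageMap G-injective (toℕ≤pred[n] j) same-side⁻¹))
    where
    module F = Automorphism p₀ p₁ p₀≢p₁ f g fg gf adj-f
    module G = Automorphism p₀ p₁ p₀≢p₁ g f gf fg (inverse-preserves-adj f g fg adj-f)

    GF : ∀ l → G.pageMap (F.pageMap l) ≡ l
    GF = F.pageMap-inverse G.pageMap G.onPage-preserved

    FG : ∀ l → F.pageMap (G.pageMap l) ≡ l
    FG = G.pageMap-inverse F.pageMap F.onPage-preserved

    F-injective : ∀ {a b} → F.pageMap a ≡ F.pageMap b → a ≡ b
    F-injective {a} {b} e = trans (sym (GF a)) (trans (cong G.pageMap e) (GF b))

    G-injective : ∀ {a b} → G.pageMap a ≡ G.pageMap b → a ≡ b
    G-injective {a} {b} e = trans (sym (FG a)) (trans (cong F.pageMap e) (FG b))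

    same-side : ∀ l → (toℕ l <ᵇ toℕ i) ≡ (toℕ (F.pageMap l) <ᵇ toℕ j)
    same-side l = begin
        toℕ l <ᵇ toℕ i
      ≡⟨ sym (parity-representative i l) ⟩
        parity (representative i) vu (cycle l)
      ≡⟨ parity-switchIso f rep-j~σ' adj-f rep-i≡σ'f (cycle-closed l) ⟩
        parity (representative j) (f vu) (map f (cycle l))
      ≡⟨ F.image-parity (λ l → toℕ l <ᵇ toℕ j) l ⟩
        toℕ (F.pageMap l) <ᵇ toℕ j
      ∎

    same-side⁻¹ : ∀ l → (toℕ l <ᵇ toℕ j) ≡ (toℕ (G.pageMap l) <ᵇ toℕ i)
    same-side⁻¹ l = sym (trans (same-side (G.pageMap l)) (cong (λ p → toℕ p <ᵇ toℕ j) (FG l)))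

-- With one page, the two representatives differ in whether the page cycle is negative.
representatives-distinct-one-page : ∀ k (i j : Fin 2) →
  SwitchIso (Book.representative k 1 i) (Book.representative k 1 j) → i ≡ j
representatives-distinct-one-page k zero       zero       _   = refl
representatives-distinct-one-page k (suc zero) (suc zero) _   = refl
representatives-distinct-one-page k zero       (suc zero) iso =
  ⊥-elim (true≢false (Book.iso-from-zero k 1 {suc zero} iso zero))
representatives-distinct-one-page k (suc zero) zero       iso =
  ⊥-elim (true≢false (Book.iso-to-zero k 1 {suc zero} iso zero))

theorem4p2 : (m n : ℕ) → 3 ≤ m → 1 ≤ n → NumClasses m n (suc n)
theorem4p2 (suc (suc (suc k))) (suc zero) _ _ =
  representative , (λ _ → canonical-signature _) , representatives-distinct-one-page k ,
  every-signature-covered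
  where open Book k 1
theorem4p2 (suc (suc (suc k))) n@(suc (suc _)) _ _ =
  representative , (λ _ → canonical-signature _) ,
  representatives-distinct-two-pages zero (suc zero) (λ ()) , every-signature-covered
  where open Book k n
theorem4p2 (suc (suc (suc k))) zero _ ()
theorem4p2 (suc (suc zero))    _    (s≤s (s≤s ())) _
theorem4p2 (suc zero)          _    (s≤s ()) _
theorem4p2 zero                _    () _
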